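{- Let $\alpha(k)$ be the largest odd divisor of $k$, $V(n)=\sum_{k=1}^n\frac{\alpha(k)}{k}$, $G(n)=\sum_{k=1}^n\frac{n+1-k}{k}\alpha(k)$, $v(n)=V(n)-\frac{2n}{3}$ (with $v(0)=0$) and $g(n)=\frac{n(n+2)}{3}-G(n)$ (with $g(0)=0$). Then: (a) For every positive integer $n$, $g(2n)=g(n)+\frac12v(n)$ and $g(2n+1)=g(n)$. (b) For every positive integer $n$ with binary representation $n=\sum_{k\ge0}\varepsilon_k2^k$ ($\varepsilon_k\in\{0,1\}$, all but finitely many zero), $g(n)=\frac12\sum_{p\ge0}(1-\varepsilon_p)\,v(\lfloor 2^{ -p-1}n\rfloor)$. (c) For every positive integer $n$, $0\le g(n)\le\frac13\lfloor\log_2 n\rfloor$.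
   Context: $\alpha(k)$ is the largest odd divisor of the positive integer $k$; $\lfloor\cdot\rfloor$ is the floor function. -}

module Defs where

open import Data.Nat as ℕ using (ℕ; zero; suc; _∸_; _⊔_; _%_; _≟_)
open import Data.Nat.Divisibility using (_∣_; _∣?_)
open import Data.Integer using (+_)
open import Data.Rational using (ℚ; 0ℚ; _+_; _-_; _/_)
open import Data.List using (List; upTo; filter; foldr)
open import Data.Product using (_×_)
open import Relation.Nullary.Decidable using (_×-dec_)
open import Relation.Binary.PropositionalEquality using (_≡_)

OddDivisorOf : ℕ → ℕ → Set
OddDivisorOf k d = (d ∣ k) × (d % 2 ≡ 1)

-- α(k) : the largest odd divisor of k, i.e. the maximum of all odd d ∈ {0,…,k}
-- dividing k (for k ≥ 1 every divisor is ≤ k, and 1 is such a divisor).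
α : ℕ → ℕ
α k = foldr _⊔_ 0 (filter (λ d → (d ∣? k) ×-dec (d % 2 ≟ 1)) (upTo (suc k)))

sumBelow : ℕ → (ℕ → ℚ) → ℚ
sumBelow zero    f = 0ℚ
sumBelow (suc n) f = sumBelow n f + f n

-- V(n) = Σ_{k=1}^{n} α(k)/k   (term i corresponds to k = i+1)
V : ℕ → ℚ
V n = sumBelow n (λ i → (+ α (suc i)) / suc i)

G : ℕ → ℚ
G n = sumBelow n (λ i → (+ ((suc n ∸ suc i) ℕ.* α (suc i))) / suc i)

-- v(n) = V(n) - 2n/3   (v(0) = 0 automatically)
v : ℕ → ℚ
v n = V n - (+ (2 ℕ.* n)) / 3

-- g(n) = n(n+2)/3 - G(n)   (g(0) = 0 automatically)
g : ℕ → ℚ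
g n = (+ (n ℕ.* (n ℕ.+ 2))) / 3 - G n

open import Data.Nat.Properties using (m^n≢0)

_/2^_ : ℕ → ℕ → ℕ
n /2^ p = ℕ._/_ n (2 ℕ.^ p) {{m^n≢0 2 p}}

bit : ℕ → ℕ → ℕ
bit n p = (n /2^ p) % 2

{-# OPTIONS --safe #-}
-- Since α(2k) = α(k) and α(2k+1) = 2k+1, we get V(2n) = V(n)/2 + n and
-- V(2n+1) = V(2n) + 1, hence v(2n) = v(n)/2 and v(2n+1) = v(n)/2 + 1/3; in
-- particular 0 ≤ v ≤ 2/3.  From G(n+1) = G(n) + V(n+1) one gets
-- g(n+1) = g(n) + 1/3 - v(n+1), and (a) follows by induction on n.  Unfolding
-- (a) along the binary digits of n gives (b); (c) follows from (a) and the
-- bounds on v by induction on the binary length of n.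
module Submission where

open import Defs
open import Data.Nat as ℕ using (ℕ; zero; suc; _∸_; _⊔_; _%_; _^_; z≤n; s≤s; NonZero)
import Data.Nat.Properties as ℕₚ
open import Data.Nat.Divisibility using (_∣_; _∣?_; ∣-refl; ∣-trans; 1∣_; n∣m*n; ∣⇒≤)
open import Data.Nat.DivMod
  using ( m≡m%n+[m/n]*n; [m+kn]%n≡m%n; m%n<n; m/n<m; m<n⇒m/n≡0; m/n/o≡m/[n*o]
        ; /-congʳ; n/1≡n)
open import Data.Nat.Coprimality using (Coprime; coprime-divisor; 1-coprimeTo; coprime-+)
open import Data.Nat.Induction using (<-rec)
open import Data.Nat.Logarithm using (⌊log₂_⌋; ⌊log₂[2*b]⌋≡1+⌊log₂b⌋; ⌊log₂⌋-mono-≤)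
open import Data.Integer as ℤ using (+_)
import Data.Integer.Properties as ℤₚ
open import Data.Rational using (ℚ; 0ℚ; 1ℚ; ½; _+_; _*_; _-_; _/_; _≤_)
open import Data.Rational.Properties
  using ( toℚᵘ-injective; toℚᵘ-homo-*; toℚᵘ-homo-+; toℚᵘ-fromℚᵘ; /-cong
        ; *-distribʳ-+; +-assoc; +-comm
        ; ≤-refl; ≤-trans; +-mono-≤; *-monoˡ-≤-nonNeg; *-monoʳ-≤-nonNeg; _≤?_
        ; nonNegative⁻¹; normalize-nonNeg; +-identityʳ)
open import Data.Rational.Unnormalised as ℚᵘ using (mkℚᵘ)
import Data.Rational.Unnormalised.Properties as ℚᵘₚ
open import Data.Rational.Solver using (module +-*-Solver)
open import Data.List using (foldr; filter; upTo)
open import Data.List.Membership.Propositional using (_∈_)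
open import Data.List.Membership.Propositional.Properties
  using (∈-filter⁺; ∈-filter⁻; ∈-upTo⁺; foldr-selective)
open import Data.List.Properties using (foldr-preservesᵒ)
import Data.List.Relation.Unary.Any as Any
open import Data.Product using (_×_; _,_; proj₁; proj₂)
open import Data.Sum using (inj₁; inj₂; [_,_])
open import Relation.Nullary.Decidable using (toWitness; _×-dec_)
open import Relation.Unary using (Decidable)
open import Relation.Binary.PropositionalEquality
  using (_≡_; refl; sym; trans; cong; cong₂; subst; subst₂; module ≡-Reasoning)
open ≡-Reasoning
open +-*-Solver

maximum-upperBound : ∀ {x xs} → x ∈ xs → x ℕ.≤ foldr _⊔_ 0 xs
maximum-upperBound {x} x∈xs =
  foldr-preservesᵒ {P = x ℕ.≤_} (λ y z → [ ℕₚ.m≤n⇒m≤n⊔o z , ℕₚ.m≤n⇒m≤o⊔n y ])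
    0 _ (inj₂ (Any.map ℕₚ.≤-reflexive x∈xs))

oddDivisorOf? : ∀ k → Decidable (OddDivisorOf k)
oddDivisorOf? k d = (d ∣? k) ×-dec (d % 2 ℕ.≟ 1)

α-greatest : ∀ {k d} → OddDivisorOf k d → d ℕ.≤ k → d ℕ.≤ α k
α-greatest {k} odd d≤k =
  maximum-upperBound (∈-filter⁺ (oddDivisorOf? k) (∈-upTo⁺ (s≤s d≤k)) odd)

α-oddDivisor : ∀ k .{{_ : NonZero k}} → OddDivisorOf k (α k)
α-oddDivisor k with foldr-selective ℕₚ.⊔-sel 0 (filter (oddDivisorOf? k) (upTo (suc k)))
... | inj₁ α≡0
  with () ← subst (1 ℕ.≤_) α≡0 (α-greatest {k} (1∣ k , refl) (ℕ.>-nonZero⁻¹ k))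
... | inj₂ α∈ = proj₂ (∈-filter⁻ (oddDivisorOf? k) {xs = upTo (suc k)} α∈)

α-unique : ∀ {k d} .{{_ : NonZero k}} →
           OddDivisorOf k d → (∀ {e} → OddDivisorOf k e → e ℕ.≤ d) → α k ≡ d
α-unique {k} d-odd greatest =
  ℕₚ.≤-antisym (greatest (α-oddDivisor k)) (α-greatest d-odd (∣⇒≤ (proj₁ d-odd)))

1+2m%2≡1 : ∀ m → suc (2 ℕ.* m) % 2 ≡ 1
1+2m%2≡1 m = trans (cong (λ n → suc n % 2) (ℕₚ.*-comm 2 m)) ([m+kn]%n≡m%n 1 m 2)

odd⇒coprime-2 : ∀ {d} → d % 2 ≡ 1 → Coprime d 2
odd⇒coprime-2 {d} d%2≡1 =
  subst (λ n → Coprime n 2) (sym d≡1+q*2) (1+q*2-coprime-2 (d ℕ./ 2))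
  where
  d≡1+q*2 : d ≡ 1 ℕ.+ (d ℕ./ 2) ℕ.* 2
  d≡1+q*2 = trans (m≡m%n+[m/n]*n d 2) (cong (ℕ._+ (d ℕ./ 2) ℕ.* 2) d%2≡1)
  1+q*2-coprime-2 : ∀ q → Coprime (1 ℕ.+ q ℕ.* 2) 2
  1+q*2-coprime-2 zero    = 1-coprimeTo 2
  1+q*2-coprime-2 (suc q) = coprime-+ (1+q*2-coprime-2 q)

α-odd : ∀ m → α (suc (2 ℕ.* m)) ≡ suc (2 ℕ.* m)
α-odd m = α-unique (∣-refl , 1+2m%2≡1 m) (λ e-odd → ∣⇒≤ (proj₁ e-odd))

α-double : ∀ m .{{_ : NonZero m}} → α (2 ℕ.* m) ≡ α m
α-double m = α-unique (∣-trans (proj₁ αm-odd) (n∣m*n 2) , proj₂ αm-odd) greatest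
  where
  instance
    2m≢0 : NonZero (2 ℕ.* m)
    2m≢0 = ℕₚ.m*n≢0 2 m
  αm-odd : OddDivisorOf m (α m)
  αm-odd = α-oddDivisor m
  greatest : ∀ {e} → OddDivisorOf (2 ℕ.* m) e → e ℕ.≤ α m
  greatest {e} (e∣2m , e-odd) = α-greatest (e∣m , e-odd) (∣⇒≤ e∣m)
    where
    e∣m : e ∣ m
    e∣m = coprime-divisor (odd⇒coprime-2 e-odd) e∣2m

data EvenOrOdd (n : ℕ) : Set where
  even : n % 2 ≡ 0 → n ≡ 2 ℕ.* (n ℕ./ 2) → EvenOrOdd n
  odd  : n % 2 ≡ 1 → n ≡ suc (2 ℕ.* (n ℕ./ 2)) → EvenOrOdd n

evenOrOdd : ∀ n → EvenOrOdd n
evenOrOdd n with n % 2 in r | m%n<n n 2 | m≡m%n+[m/n]*n n 2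
... | 0 | _ | n≡q*2   = even r (trans n≡q*2 (ℕₚ.*-comm (n ℕ./ 2) 2))
... | 1 | _ | n≡1+q*2 = odd r (trans n≡1+q*2 (cong suc (ℕₚ.*-comm (n ℕ./ 2) 2)))
... | suc (suc _) | s≤s (s≤s ()) | _

binary-ind : (P : ℕ → Set) → P 0 → (∀ m → P m → P (2 ℕ.* m)) →
             (∀ m → P m → P (suc (2 ℕ.* m))) → ∀ n → P n
binary-ind P P0 P-double P-double+1 = <-rec P step
  where
  step : ∀ n → (∀ {m} → m ℕ.< n → P m) → P n
  step zero      _   = P0
  step n@(suc _) rec with evenOrOdd n
  ... | even _ n≡2q   =
    subst P (sym n≡2q)   (P-double   _ (rec (m/n<m n 2 (s≤s (s≤s z≤n)))))
  ... | odd  _ n≡2q+1 =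
    subst P (sym n≡2q+1) (P-double+1 _ (rec (m/n<m n 2 (s≤s (s≤s z≤n)))))

n<2^n : ∀ n → n ℕ.< 2 ^ n
n<2^n zero    = s≤s z≤n
n<2^n (suc n) =
  ℕₚ.+-mono-≤ (ℕₚ.m^n>0 2 n) (ℕₚ.≤-trans (n<2^n n) (ℕₚ.m≤m+n (2 ^ n) 0))

/2^-suc : ∀ n p → (n /2^ p) ℕ./ 2 ≡ n /2^ suc p
/2^-suc n p = trans (m/n/o≡m/[n*o] n (2 ^ p) 2) (/-congʳ (ℕₚ.*-comm (2 ^ p) 2))
  where
  instance
    2^p≢0 : NonZero (2 ^ p)
    2^p≢0 = ℕₚ.m^n≢0 2 p
    2^p*2≢0 : NonZero (2 ^ p ℕ.* 2)
    2^p*2≢0 = ℕₚ.m*n≢0 (2 ^ p) 2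
    2^[1+p]≢0 : NonZero (2 ^ suc p)
    2^[1+p]≢0 = ℕₚ.m^n≢0 2 (suc p)

n/2^n≡0 : ∀ n → n /2^ n ≡ 0
n/2^n≡0 n = m<n⇒m/n≡0 {{ℕₚ.m^n≢0 2 n}} (n<2^n n)

ι : ℕ → ℚ
ι k = + k / 1

⅓ : ℚ
⅓ = + 1 / 3

⅔ : ℚ
⅔ = + 2 / 3

-- Both sides normalise the same unnormalised fraction.
/-*-/ : ∀ i j m n → (i / suc m) * (j / suc n) ≡ (i ℤ.* j) / (suc m ℕ.* suc n)
/-*-/ i j m n = toℚᵘ-injective (ℚᵘₚ.≃-trans (toℚᵘ-homo-* (i / suc m) (j / suc n))
  (ℚᵘₚ.≃-trans (ℚᵘₚ.*-cong (toℚᵘ-fromℚᵘ (mkℚᵘ i m)) (toℚᵘ-fromℚᵘ (mkℚᵘ j n)))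
    (ℚᵘₚ.≃-sym (toℚᵘ-fromℚᵘ (mkℚᵘ i m ℚᵘ.* mkℚᵘ j n)))))

/-+-/ : ∀ i j m n →
        (i / suc m) + (j / suc n) ≡ (i ℤ.* + suc n ℤ.+ j ℤ.* + suc m) / (suc m ℕ.* suc n)
/-+-/ i j m n = toℚᵘ-injective (ℚᵘₚ.≃-trans (toℚᵘ-homo-+ (i / suc m) (j / suc n))
  (ℚᵘₚ.≃-trans (ℚᵘₚ.+-cong (toℚᵘ-fromℚᵘ (mkℚᵘ i m)) (toℚᵘ-fromℚᵘ (mkℚᵘ j n)))
    (ℚᵘₚ.≃-sym (toℚᵘ-fromℚᵘ (mkℚᵘ i m ℚᵘ.+ mkℚᵘ j n)))))

ι-homo-+ : ∀ a b → ι (a ℕ.+ b) ≡ ι a + ι b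
ι-homo-+ a b = sym (trans (/-+-/ (+ a) (+ b) 0 0)
  (/-cong (cong₂ ℤ._+_ (ℤₚ.*-identityʳ (+ a)) (ℤₚ.*-identityʳ (+ b))) refl))

ι-homo-* : ∀ a b → ι (a ℕ.* b) ≡ ι a * ι b
ι-homo-* a b = sym (trans (/-*-/ (+ a) (+ b) 0 0) (/-cong (sym (ℤₚ.pos-* a b)) refl))

ι-mono-≤ : ∀ {a b} → a ℕ.≤ b → ι a ≤ ι b
ι-mono-≤ {a} {b} a≤b = subst₂ _≤_ (+-identityʳ (ι a))
  (trans (sym (ι-homo-+ a (b ∸ a))) (cong ι (ℕₚ.m+[n∸m]≡n a≤b)))
  (+-mono-≤ (≤-refl {ι a}) (nonNegative⁻¹ (ι (b ∸ a)) {{normalize-nonNeg (b ∸ a) 1}}))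

/-as-* : ∀ a m → + a / suc m ≡ ι a * (+ 1 / suc m)
/-as-* a m = sym (trans (/-*-/ (+ a) (+ 1) 0 m)
  (/-cong (ℤₚ.*-identityʳ (+ a)) (ℕₚ.+-identityʳ (suc m))))

/[2*d]≡½*/d : ∀ a m → + a / (2 ℕ.* suc m) ≡ ½ * (+ a / suc m)
/[2*d]≡½*/d a m = sym (trans (/-*-/ (+ 1) (+ a) 1 m) (/-cong (ℤₚ.*-identityˡ (+ a)) refl))

n/n≡1 : ∀ m → + suc m / suc m ≡ 1ℚ
n/n≡1 m = toℚᵘ-injective
  (ℚᵘₚ.≃-trans (toℚᵘ-fromℚᵘ (mkℚᵘ (+ suc m) m)) (ℚᵘ.*≡* (ℤₚ.*-comm (+ suc m) (+ 1))))

+-distrib-/ : ∀ a b m → + (a ℕ.+ b) / suc m ≡ + a / suc m + + b / suc m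
+-distrib-/ a b m = begin
  + (a ℕ.+ b) / suc m
    ≡⟨ /-as-* (a ℕ.+ b) m ⟩
  ι (a ℕ.+ b) * (+ 1 / suc m)
    ≡⟨ cong (_* (+ 1 / suc m)) (ι-homo-+ a b) ⟩
  (ι a + ι b) * (+ 1 / suc m)
    ≡⟨ *-distribʳ-+ (+ 1 / suc m) (ι a) (ι b) ⟩
  ι a * (+ 1 / suc m) + ι b * (+ 1 / suc m)
    ≡⟨ sym (cong₂ _+_ (/-as-* a m) (/-as-* b m)) ⟩
  + a / suc m + + b / suc m ∎

sumBelow-cong : ∀ n {f h : ℕ → ℚ} →
                (∀ {i} → i ℕ.< n → f i ≡ h i) → sumBelow n f ≡ sumBelow n h
sumBelow-cong zero    f≗h = refl
sumBelow-cong (suc n) f≗h =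
  cong₂ _+_ (sumBelow-cong n (λ i<n → f≗h (ℕₚ.m<n⇒m<1+n i<n))) (f≗h ℕₚ.≤-refl)

sumBelow-+ : ∀ n f h → sumBelow n (λ i → f i + h i) ≡ sumBelow n f + sumBelow n h
sumBelow-+ zero    f h = refl
sumBelow-+ (suc n) f h = begin
  sumBelow n (λ i → f i + h i) + (f n + h n)
    ≡⟨ cong (_+ (f n + h n)) (sumBelow-+ n f h) ⟩
  (sumBelow n f + sumBelow n h) + (f n + h n)
    ≡⟨ solve 4 (λ a b c d → (a :+ b) :+ (c :+ d) := (a :+ c) :+ (b :+ d)) refl
         (sumBelow n f) (sumBelow n h) (f n) (h n) ⟩
  (sumBelow n f + f n) + (sumBelow n h + h n) ∎

V-term : ℕ → ℚ
V-term i = + α (suc i) / suc i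

G-term : ℕ → ℕ → ℚ
G-term n i = + ((suc n ∸ suc i) ℕ.* α (suc i)) / suc i

G-term-suc : ∀ {n i} → i ℕ.< n → G-term (suc n) i ≡ G-term n i + V-term i
G-term-suc {n} {i} i<n = begin
  + ((suc n ∸ i) ℕ.* α (suc i)) / suc i
    ≡⟨ /-cong (cong (λ k → + (k ℕ.* α (suc i))) (ℕₚ.+-∸-assoc 1 (ℕₚ.<⇒≤ i<n))) refl ⟩
  + (α (suc i) ℕ.+ (n ∸ i) ℕ.* α (suc i)) / suc i
    ≡⟨ +-distrib-/ (α (suc i)) _ i ⟩
  V-term i + G-term n i
    ≡⟨ +-comm (V-term i) (G-term n i) ⟩
  G-term n i + V-term i ∎

G-term-last : ∀ n → G-term (suc n) n ≡ V-term n
G-term-last n = /-cong (cong +_ (trans (cong (ℕ._* α (suc n)) (ℕₚ.m+n∸n≡m 1 n))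
                                       (ℕₚ.*-identityˡ (α (suc n))))) refl

G-suc : ∀ n → G (suc n) ≡ G n + V (suc n)
G-suc n = begin
  sumBelow n (G-term (suc n)) + G-term (suc n) n
    ≡⟨ cong₂ _+_ (sumBelow-cong n G-term-suc) (G-term-last n) ⟩
  sumBelow n (λ i → G-term n i + V-term i) + V-term n
    ≡⟨ cong (_+ V-term n) (sumBelow-+ n (G-term n) V-term) ⟩
  (G n + V n) + V-term n
    ≡⟨ +-assoc (G n) (V n) (V-term n) ⟩
  G n + V (suc n) ∎

V-double+1 : ∀ m → V (suc (2 ℕ.* m)) ≡ V (2 ℕ.* m) + 1ℚ
V-double+1 m =
  cong (_+_ (V (2 ℕ.* m))) (trans (/-cong (cong +_ (α-odd m)) refl) (n/n≡1 (2 ℕ.* m)))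

V-term-double : ∀ m → V-term (suc (2 ℕ.* m)) ≡ ½ * V-term m
V-term-double m = begin
  + α (suc (suc (2 ℕ.* m))) / suc (suc (2 ℕ.* m))
    ≡⟨ /-cong (cong (λ k → + α k) (sym (ℕₚ.*-suc 2 m))) (sym (ℕₚ.*-suc 2 m)) ⟩
  + α (2 ℕ.* suc m) / (2 ℕ.* suc m)
    ≡⟨ /-cong (cong +_ (α-double (suc m))) refl ⟩
  + α (suc m) / (2 ℕ.* suc m)
    ≡⟨ /[2*d]≡½*/d (α (suc m)) m ⟩
  ½ * V-term m ∎

V-double : ∀ m → V (2 ℕ.* m) ≡ ½ * V m + ι m
V-double zero    = refl
V-double (suc m) = begin
  V (2 ℕ.* suc m)
    ≡⟨ cong V (ℕₚ.*-suc 2 m) ⟩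
  V (suc (2 ℕ.* m)) + V-term (suc (2 ℕ.* m))
    ≡⟨ cong₂ _+_ (trans (V-double+1 m) (cong (_+ 1ℚ) (V-double m))) (V-term-double m) ⟩
  (½ * V m + ι m + 1ℚ) + ½ * V-term m
    ≡⟨ solve 3 (λ x y a → (con ½ :* x :+ y :+ con 1ℚ) :+ con ½ :* a
                        := con ½ :* (x :+ a) :+ (con 1ℚ :+ y)) refl (V m) (ι m) (V-term m) ⟩
  ½ * V (suc m) + (1ℚ + ι m)
    ≡⟨ cong (_+_ (½ * V (suc m))) (sym (ι-homo-+ 1 m)) ⟩
  ½ * V (suc m) + ι (suc m) ∎

v-as : ∀ m → v m ≡ V m - ι 2 * ι m * ⅓
v-as m = cong (V m -_) (trans (/-as-* (2 ℕ.* m) 2) (cong (_* ⅓) (ι-homo-* 2 m)))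

v-double : ∀ m → v (2 ℕ.* m) ≡ ½ * v m
v-double m = begin
  v (2 ℕ.* m)
    ≡⟨ v-as (2 ℕ.* m) ⟩
  V (2 ℕ.* m) - ι 2 * ι (2 ℕ.* m) * ⅓
    ≡⟨ cong₂ (λ x y → x - ι 2 * y * ⅓) (V-double m) (ι-homo-* 2 m) ⟩
  (½ * V m + ι m) - ι 2 * (ι 2 * ι m) * ⅓
    ≡⟨ solve 2 (λ x y → (con ½ :* x :+ y) :- con (ι 2) :* (con (ι 2) :* y) :* con ⅓
                      := con ½ :* (x :- con (ι 2) :* y :* con ⅓)) refl (V m) (ι m) ⟩
  ½ * (V m - ι 2 * ι m * ⅓)
    ≡⟨ cong (½ *_) (sym (v-as m)) ⟩
  ½ * v m ∎

v-double+1 : ∀ m → v (suc (2 ℕ.* m)) ≡ ½ * v m + ⅓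
v-double+1 m = begin
  v (suc (2 ℕ.* m))
    ≡⟨ v-as (suc (2 ℕ.* m)) ⟩
  V (suc (2 ℕ.* m)) - ι 2 * ι (1 ℕ.+ 2 ℕ.* m) * ⅓
    ≡⟨ cong₂ (λ x y → x - ι 2 * y * ⅓) (trans (V-double+1 m) (cong (_+ 1ℚ) (V-double m)))
             (trans (ι-homo-+ 1 (2 ℕ.* m)) (cong (_+_ 1ℚ) (ι-homo-* 2 m))) ⟩
  (½ * V m + ι m + 1ℚ) - ι 2 * (1ℚ + ι 2 * ι m) * ⅓
    ≡⟨ solve 2 (λ x y → (con ½ :* x :+ y :+ con 1ℚ)
                        :- con (ι 2) :* (con 1ℚ :+ con (ι 2) :* y) :* con ⅓
                      := con ½ :* (x :- con (ι 2) :* y :* con ⅓) :+ con ⅓) refl (V m) (ι m) ⟩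
  ½ * (V m - ι 2 * ι m * ⅓) + ⅓
    ≡⟨ cong (λ x → ½ * x + ⅓) (sym (v-as m)) ⟩
  ½ * v m + ⅓ ∎

g-as : ∀ m → g m ≡ ι m * (ι m + ι 2) * ⅓ - G m
g-as m = cong (_- G m) (trans (/-as-* (m ℕ.* (m ℕ.+ 2)) 2)
  (cong (_* ⅓) (trans (ι-homo-* m (m ℕ.+ 2)) (cong (ι m *_) (ι-homo-+ m 2)))))

-- The quadratic part of g grows by (2n+3)/3, of which 2(n+1)/3 cancels against V(n+1).
g-suc : ∀ n → g (suc n) ≡ g n + ⅓ - v (suc n)
g-suc n = begin
  g (suc n)
    ≡⟨ g-as (suc n) ⟩
  ι (suc n) * (ι (suc n) + ι 2) * ⅓ - G (suc n)
    ≡⟨ cong₂ (λ x y → x * (x + ι 2) * ⅓ - y) (ι-homo-+ 1 n) (G-suc n) ⟩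
  (1ℚ + ι n) * ((1ℚ + ι n) + ι 2) * ⅓ - (G n + V (suc n))
    ≡⟨ solve 3 (λ x G W → (con 1ℚ :+ x) :* ((con 1ℚ :+ x) :+ con (ι 2)) :* con ⅓ :- (G :+ W)
                        := (x :* (x :+ con (ι 2)) :* con ⅓ :- G) :+ con ⅓
                           :- (W :- con (ι 2) :* (con 1ℚ :+ x) :* con ⅓))
         refl (ι n) (G n) (V (suc n)) ⟩
  (ι n * (ι n + ι 2) * ⅓ - G n) + ⅓ - (V (suc n) - ι 2 * (1ℚ + ι n) * ⅓)
    ≡⟨ cong₂ (λ x y → x + ⅓ - y) (sym (g-as n))
             (sym (trans (v-as (suc n)) (cong (λ x → V (suc n) - ι 2 * x * ⅓) (ι-homo-+ 1 n)))) ⟩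
  g n + ⅓ - v (suc n) ∎

g-double   : ∀ m → g (2 ℕ.* m) ≡ g m + ½ * v m
g-double+1 : ∀ m → g (suc (2 ℕ.* m)) ≡ g m

g-double+1 m = begin
  g (suc (2 ℕ.* m))
    ≡⟨ g-suc (2 ℕ.* m) ⟩
  g (2 ℕ.* m) + ⅓ - v (suc (2 ℕ.* m))
    ≡⟨ cong₂ (λ x y → x + ⅓ - y) (g-double m) (v-double+1 m) ⟩
  (g m + ½ * v m) + ⅓ - (½ * v m + ⅓)
    ≡⟨ solve 2 (λ x y → (x :+ con ½ :* y) :+ con ⅓ :- (con ½ :* y :+ con ⅓) := x)
         refl (g m) (v m) ⟩
  g m ∎

g-double zero    = refl
g-double (suc m) = begin
  g (2 ℕ.* suc m)
    ≡⟨ cong g (ℕₚ.*-suc 2 m) ⟩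
  g (suc (suc (2 ℕ.* m)))
    ≡⟨ g-suc (suc (2 ℕ.* m)) ⟩
  g (suc (2 ℕ.* m)) + ⅓ - v (suc (suc (2 ℕ.* m)))
    ≡⟨ cong₂ (λ x y → x + ⅓ - y) (g-double+1 m)
             (trans (cong v (sym (ℕₚ.*-suc 2 m))) (v-double (suc m))) ⟩
  g m + ⅓ - ½ * v (suc m)
    ≡⟨ solve 2 (λ x y → x :+ con ⅓ :- con ½ :* y := (x :+ con ⅓ :- y) :+ con ½ :* y)
         refl (g m) (v (suc m)) ⟩
  (g m + ⅓ - v (suc m)) + ½ * v (suc m)
    ≡⟨ cong (_+ ½ * v (suc m)) (sym (g-suc m)) ⟩
  g (suc m) + ½ * v (suc m) ∎

module BinaryExpansion (f w : ℕ → ℚ) (c : ℚ)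
  (f-double   : ∀ m → f (2 ℕ.* m) ≡ f m + c * w m)
  (f-double+1 : ∀ m → f (suc (2 ℕ.* m)) ≡ f m) where

  f-halve : ∀ x → f x ≡ c * (ι (1 ∸ x % 2) * w (x ℕ./ 2)) + f (x ℕ./ 2)
  f-halve x with evenOrOdd x
  ... | even x%2≡0 x≡2q = begin
    f x
      ≡⟨ cong f x≡2q ⟩
    f (2 ℕ.* q)
      ≡⟨ f-double q ⟩
    f q + c * w q
      ≡⟨ solve 3 (λ a b d → a :+ b :* d := b :* (con (ι 1) :* d) :+ a) refl (f q) c (w q) ⟩
    c * (ι 1 * w q) + f q
      ≡⟨ cong (λ r → c * (ι (1 ∸ r) * w q) + f q) (sym x%2≡0) ⟩
    c * (ι (1 ∸ x % 2) * w q) + f q ∎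
    where
    q : ℕ
    q = x ℕ./ 2
  ... | odd x%2≡1 x≡2q+1 = begin
    f x
      ≡⟨ cong f x≡2q+1 ⟩
    f (suc (2 ℕ.* q))
      ≡⟨ f-double+1 q ⟩
    f q
      ≡⟨ solve 3 (λ a b d → a := b :* (con (ι 0) :* d) :+ a) refl (f q) c (w q) ⟩
    c * (ι 0 * w q) + f q
      ≡⟨ cong (λ r → c * (ι (1 ∸ r) * w q) + f q) (sym x%2≡1) ⟩
    c * (ι (1 ∸ x % 2) * w q) + f q ∎
    where
    q : ℕ
    q = x ℕ./ 2

  zeroDigitSum : ℕ → ℕ → ℚ
  zeroDigitSum n N = sumBelow N (λ p → ι (1 ∸ bit n p) * w (n /2^ suc p))

  f-expansion : ∀ N n → f n ≡ c * zeroDigitSum n N + f (n /2^ N)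
  f-expansion zero    n = begin
    f n
      ≡⟨ cong f (sym (n/1≡n n)) ⟩
    f (n /2^ 0)
      ≡⟨ solve 2 (λ a b → a := b :* con 0ℚ :+ a) refl (f (n /2^ 0)) c ⟩
    c * 0ℚ + f (n /2^ 0) ∎
  f-expansion (suc N) n = begin
    f n
      ≡⟨ f-expansion N n ⟩
    c * S + f x
      ≡⟨ cong (_+_ (c * S)) (f-halve x) ⟩
    c * S + (c * (ι (1 ∸ bit n N) * w (x ℕ./ 2)) + f (x ℕ./ 2))
      ≡⟨ cong (λ y → c * S + (c * (ι (1 ∸ bit n N) * w y) + f y)) (/2^-suc n N) ⟩
    c * S + (c * t + f (n /2^ suc N))
      ≡⟨ solve 4 (λ a b d e → a :* b :+ (a :* d :+ e) := a :* (b :+ d) :+ e) refl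
           c S t (f (n /2^ suc N)) ⟩
    c * zeroDigitSum n (suc N) + f (n /2^ suc N) ∎
    where
    x : ℕ
    x = n /2^ N
    S t : ℚ
    S = zeroDigitSum n N
    t = ι (1 ∸ bit n N) * w (n /2^ suc N)

  f-binaryExpansion : f 0 ≡ 0ℚ → ∀ n → f n ≡ c * zeroDigitSum n n
  f-binaryExpansion f0≡0 n = begin
    f n
      ≡⟨ f-expansion n n ⟩
    c * zeroDigitSum n n + f (n /2^ n)
      ≡⟨ cong (λ y → c * zeroDigitSum n n + f y) (n/2^n≡0 n) ⟩
    c * zeroDigitSum n n + f 0
      ≡⟨ cong (_+_ (c * zeroDigitSum n n)) f0≡0 ⟩
    c * zeroDigitSum n n + 0ℚ
      ≡⟨ +-identityʳ (c * zeroDigitSum n n) ⟩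
    c * zeroDigitSum n n ∎

½*-nonNeg : ∀ {x} → 0ℚ ≤ x → 0ℚ ≤ ½ * x
½*-nonNeg = *-monoˡ-≤-nonNeg ½

v-bounds : ∀ n → 0ℚ ≤ v n × v n ≤ ⅔
v-bounds = binary-ind (λ n → within (v n))
  (toWitness {a? = 0ℚ ≤? v 0} _ , toWitness {a? = v 0 ≤? ⅔} _) double double+1
  where
  within : ℚ → Set
  within x = 0ℚ ≤ x × x ≤ ⅔
  double : ∀ m → within (v m) → within (v (2 ℕ.* m))
  double m (lo , hi) = subst within (sym (v-double m))
    ( ½*-nonNeg lo
    , ≤-trans (*-monoˡ-≤-nonNeg ½ hi) (toWitness {a? = ½ * ⅔ ≤? ⅔} _))
  double+1 : ∀ m → within (v m) → within (v (suc (2 ℕ.* m)))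
  double+1 m (lo , hi) = subst within (sym (v-double+1 m))
    ( +-mono-≤ (½*-nonNeg lo) (toWitness {a? = 0ℚ ≤? ⅓} _)
    , +-mono-≤ (*-monoˡ-≤-nonNeg ½ hi) ≤-refl)

g-nonNeg : ∀ n → 0ℚ ≤ g n
g-nonNeg = binary-ind (λ n → 0ℚ ≤ g n) ≤-refl double double+1
  where
  double : ∀ m → 0ℚ ≤ g m → 0ℚ ≤ g (2 ℕ.* m)
  double m 0≤gm = subst (0ℚ ≤_) (sym (g-double m))
    (+-mono-≤ 0≤gm (½*-nonNeg (proj₁ (v-bounds m))))
  double+1 : ∀ m → 0ℚ ≤ g m → 0ℚ ≤ g (suc (2 ℕ.* m))
  double+1 m 0≤gm = subst (0ℚ ≤_) (sym (g-double+1 m)) 0≤gm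

g≤⅓log₂ : ∀ n .{{_ : NonZero n}} → g n ≤ ι ⌊log₂ n ⌋ * ⅓
g≤⅓log₂ = binary-ind P zero-case double double+1
  where
  P : ℕ → Set
  P n = .{{_ : NonZero n}} → g n ≤ ι ⌊log₂ n ⌋ * ⅓
  zero-case : P 0
  zero-case {{()}}
  double : ∀ m → P m → P (2 ℕ.* m)
  double m ih = subst₂ _≤_ (sym (g-double m)) bound≡
    (+-mono-≤ ih (*-monoˡ-≤-nonNeg ½ (proj₂ (v-bounds m))))
    where
    instance
      m≢0 : NonZero m
      m≢0 = ℕₚ.m*n≢0⇒n≢0 2
    bound≡ : ι ⌊log₂ m ⌋ * ⅓ + ½ * ⅔ ≡ ι ⌊log₂ (2 ℕ.* m) ⌋ * ⅓
    bound≡ = begin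
      ι ⌊log₂ m ⌋ * ⅓ + ½ * ⅔
        ≡⟨ solve 1 (λ l → l :* con ⅓ :+ con ½ :* con ⅔ := (con 1ℚ :+ l) :* con ⅓)
             refl (ι ⌊log₂ m ⌋) ⟩
      (1ℚ + ι ⌊log₂ m ⌋) * ⅓
        ≡⟨ cong (_* ⅓) (sym (ι-homo-+ 1 ⌊log₂ m ⌋)) ⟩
      ι (1 ℕ.+ ⌊log₂ m ⌋) * ⅓
        ≡⟨ cong (λ l → ι l * ⅓) (sym (⌊log₂[2*b]⌋≡1+⌊log₂b⌋ m)) ⟩
      ι ⌊log₂ (2 ℕ.* m) ⌋ * ⅓ ∎
  double+1 : ∀ m → P m → P (suc (2 ℕ.* m))
  double+1 zero    _  = toWitness {a? = g 1 ≤? ι 0 * ⅓} _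
  double+1 (suc k) ih = subst (_≤ ι ⌊log₂ (suc (2 ℕ.* m)) ⌋ * ⅓) (sym (g-double+1 m))
    (≤-trans ih (*-monoʳ-≤-nonNeg ⅓ (ι-mono-≤ (⌊log₂⌋-mono-≤ m≤2m+1))))
    where
    m : ℕ
    m = suc k
    m≤2m+1 : m ℕ.≤ suc (2 ℕ.* m)
    m≤2m+1 = ℕₚ.≤-trans (ℕₚ.m≤n*m m 2) (ℕₚ.n≤1+n (2 ℕ.* m))

proposition5 :
    ((n : ℕ) → .{{_ : NonZero n}} →
        (g (2 ℕ.* n) ≡ g n + ½ * v n) × (g (suc (2 ℕ.* n)) ≡ g n))
    × ((n : ℕ) → .{{_ : NonZero n}} →
        g n ≡ ½ * sumBelow n (λ p → (+ (1 ∸ bit n p)) / 1 * v (n /2^ suc p)))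
    × ((n : ℕ) → .{{_ : NonZero n}} →
        (0ℚ ≤ g n) × (g n ≤ (+ ⌊log₂ n ⌋) / 3))
proposition5 =
    (λ n → g-double n , g-double+1 n)
  , (λ n → BinaryExpansion.f-binaryExpansion g v ½ g-double g-double+1 refl n)
  , (λ n → g-nonNeg n , subst (g n ≤_) (sym (/-as-* ⌊log₂ n ⌋ 2)) (g≤⅓log₂ n))
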